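{- Let $G$ and $H$ be bicolored digraphs which both have a bikernel. Then the bicolored Cartesian product $G\square H$ has a bikernel.
   Context: A bicolored digraph has each arc colored $1$ or $2$. The Cartesian product $D_1\square D_2$ has vertex set $V(D_1)\times V(D_2)$ and arcs $((u,v_1),(u,v_2))$ for $u\in V(D_1)$, $(v_1,v_2)\in A(D_2)$, and $((u_1,v),(u_2,v))$ for $v\in V(D_2)$, $(u_1,u_2)\in A(D_1)$; an arc $((u_1,v),(u_2,v))$ receives the color of $(u_1,u_2)$ in $D_1$ and an arc $((u,v_1),(u,v_2))$ the color of $(v_1,v_2)$ in $D_2$. A non-empty set $B\subseteq V(G)$ is a bikernel (by monochromatic paths) if: (i) for all distinct $u,v\in B$ there is no monochromatic directed $uv$-path; (ii) for every $v\in V(G)\setminus B$ there is a directed path of color $1$ from $v$ to a vertex of $B$; (iii) for every $v\in V(G)\setminus B$ there is a directed path of color $2$ from a vertex of $B$ to $v$. -}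

module Defs where

open import Level using (0ℓ)
open import Data.Nat using (ℕ)
open import Data.Fin using (Fin)
open import Data.Product using (Σ; ∃; _×_; _,_)
open import Data.Bool using (Bool; true)
open import Relation.Nullary using (¬_)
open import Relation.Binary.PropositionalEquality using (_≡_)
open import Relation.Binary.Construct.Closure.Transitive using (TransClosure)
open import Function.Bundles using (_↔_)

data Color : Set where
  c1 c2 : Color

record BiDigraph : Set₁ where
  field
    V   : Set
    Arc : V → V → Color → Set
open BiDigraph public

-- Standing conventions (as in the paper): digraphs are finite, have no
-- loops, and every arc carries exactly one colour (and is a single arc).
record IsFiniteBiDigraph (D : BiDigraph) : Set where
  field
    size       : ℕ
    enum       : V D ↔ Fin size
    loopless   : ∀ {v c} → ¬ Arc D v v c
    oneColour  : ∀ {u v c c′} → Arc D u v c → Arc D u v c′ → c ≡ c′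
    arcProp    : ∀ {u v c} (a b : Arc D u v c) → a ≡ b

data ProdArc (D₁ D₂ : BiDigraph) : V D₁ × V D₂ → V D₁ × V D₂ → Color → Set where
  right : ∀ {u v₁ v₂ c} → Arc D₂ v₁ v₂ c → ProdArc D₁ D₂ (u , v₁) (u , v₂) c
  left  : ∀ {u₁ u₂ v c} → Arc D₁ u₁ u₂ c → ProdArc D₁ D₂ (u₁ , v) (u₂ , v) c

_□_ : BiDigraph → BiDigraph → BiDigraph
D₁ □ D₂ = record { V = V D₁ × V D₂ ; Arc = ProdArc D₁ D₂ }

-- Existence of a directed path of colour c from u to v (with at least one
-- arc).  A path exists iff a nonempty walk exists, so we use nonempty walks.
MonoPath : (D : BiDigraph) → Color → V D → V D → Set
MonoPath D c = TransClosure (λ x y → Arc D x y c)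

_∈_ : {A : Set} → A → (A → Bool) → Set
x ∈ B = B x ≡ true

record IsBikernel (D : BiDigraph) (B : V D → Bool) : Set where
  field
    nonempty    : ∃ λ b → b ∈ B
    independent : ∀ u v → u ∈ B → v ∈ B → ¬ (u ≡ v) → ∀ c → ¬ MonoPath D c u v
    absorbing   : ∀ v → ¬ (v ∈ B) → ∃ λ b → b ∈ B × MonoPath D c1 v b
    dominating  : ∀ v → ¬ (v ∈ B) → ∃ λ b → b ∈ B × MonoPath D c2 b v

HasBikernel : BiDigraph → Set
HasBikernel D = Σ (V D → Bool) λ B → IsBikernel D B

module Submission where

open import Defs
open import Data.Bool using (Bool; true; _∧_)
import Data.Bool.Properties as Bool
open import Data.Empty using (⊥-elim)
import Data.Fin.Properties as Fin
open import Data.Product using (∃; _×_; _,_; proj₁; proj₂)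
open import Function.Properties.Inverse using (↔⇒↣)
open import Relation.Binary.Construct.Closure.ReflexiveTransitive
  using (Star; ε; _◅_; _◅◅_; gmap; kleisliStar)
open import Relation.Binary.Construct.Closure.Transitive using ([_]; _∷_)
open import Relation.Binary.Definitions using (DecidableEquality)
open import Relation.Binary.PropositionalEquality using (_≢_; refl; cong; ≢-sym)
open import Relation.Nullary using (¬_; yes; no)
open import Relation.Nullary.Decidable using (via-injection)

-- The product B × C of bikernels of G and H is a bikernel of G □ H.  A
-- monochromatic path in G □ H projects to (possibly empty) monochromatic walks
-- in G and in H, so a path between distinct vertices of B × C gives a nonempty
-- path between distinct kernel vertices of a factor where they differ.  Walks
-- in the factors lift to G □ H, so (x , y) reaches B × C by walking x to B and
-- then y to C (and dually).  Finiteness is used only to decide in which factor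
-- two vertices differ.

Walk : (D : BiDigraph) → Color → V D → V D → Set
Walk D c = Star (λ x y → Arc D x y c)

module _ (D : BiDigraph) {c : Color} where

  path⇒walk : ∀ {x y} → MonoPath D c x y → Walk D c x y
  path⇒walk [ a ]    = a ◅ ε
  path⇒walk (a ∷ as) = a ◅ path⇒walk as

  walk⇒path : ∀ {x y} → Walk D c x y → x ≢ y → MonoPath D c x y
  walk⇒path ε        x≢x = ⊥-elim (x≢x refl)
  walk⇒path (a ◅ as) _   = arc◅walk⇒path a as
    where
    arc◅walk⇒path : ∀ {x y z} → Arc D x y c → Walk D c y z → MonoPath D c x z
    arc◅walk⇒path a ε        = [ a ]
    arc◅walk⇒path a (b ◅ bs) = a ∷ arc◅walk⇒path b bs

finite⇒decidableEquality : ∀ {D} → IsFiniteBiDigraph D → DecidableEquality (V D)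
finite⇒decidableEquality F = via-injection (↔⇒↣ (IsFiniteBiDigraph.enum F)) Fin._≟_

module _ {G H : BiDigraph} {c : Color} where

  liftˡ : ∀ {x x′} (y : V H) → Walk G c x x′ → Walk (G □ H) c (x , y) (x′ , y)
  liftˡ y = gmap (_, y) left

  liftʳ : ∀ {y y′} (x : V G) → Walk H c y y′ → Walk (G □ H) c (x , y) (x , y′)
  liftʳ x = gmap (x ,_) right

  projˡ : ∀ {x y x′ y′} → Walk (G □ H) c (x , y) (x′ , y′) → Walk G c x x′
  projˡ = kleisliStar proj₁ arcˡ
    where
    arcˡ : ∀ {p q} → ProdArc G H p q c → Walk G c (proj₁ p) (proj₁ q)
    arcˡ (right a) = ε
    arcˡ (left a)  = a ◅ ε

  projʳ : ∀ {x y x′ y′} → Walk (G □ H) c (x , y) (x′ , y′) → Walk H c y y′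
  projʳ = kleisliStar proj₂ arcʳ
    where
    arcʳ : ∀ {p q} → ProdArc G H p q c → Walk H c (proj₂ p) (proj₂ q)
    arcʳ (right a) = a ◅ ε
    arcʳ (left a)  = ε

module _ {D : BiDigraph} {B : V D → Bool} (K : IsBikernel D B) where
  open IsBikernel K

  walkToKernel : ∀ v → ∃ λ b → b ∈ B × Walk D c1 v b
  walkToKernel v with B v Bool.≟ true
  ... | yes v∈B = v , v∈B , ε
  ... | no v∉B with absorbing v v∉B
  ...   | b , b∈B , p = b , b∈B , path⇒walk D p

  walkFromKernel : ∀ v → ∃ λ b → b ∈ B × Walk D c2 b v
  walkFromKernel v with B v Bool.≟ true
  ... | yes v∈B = v , v∈B , ε
  ... | no v∉B with dominating v v∉B
  ...   | b , b∈B , p = b , b∈B , path⇒walk D p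

_×ᵇ_ : {A C : Set} → (A → Bool) → (C → Bool) → A × C → Bool
(B ×ᵇ C) (x , y) = B x ∧ C y

module _ {A C : Set} (B : A → Bool) (D : C → Bool) {x : A} {y : C} where

  ∈-×ᵇ⁺ : x ∈ B → y ∈ D → (x , y) ∈ (B ×ᵇ D)
  ∈-×ᵇ⁺ x∈B y∈D rewrite x∈B | y∈D = refl

  ∈-×ᵇ⁻ : (x , y) ∈ (B ×ᵇ D) → x ∈ B × y ∈ D
  ∈-×ᵇ⁻ xy∈ with B x | D y
  ∈-×ᵇ⁻ refl | true | true = refl , refl

∉-∈⇒≢ : {A : Set} (B : A → Bool) {v b : A} → ¬ v ∈ B → b ∈ B → v ≢ b
∉-∈⇒≢ B v∉B b∈B refl = v∉B b∈B

module _ {G H : BiDigraph} {B : V G → Bool} {C : V H → Bool} where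

  □-isBikernel : DecidableEquality (V G) → IsBikernel G B → IsBikernel H C →
                 IsBikernel (G □ H) (B ×ᵇ C)
  □-isBikernel _≟_ KG KH = record
    { nonempty    = nonempty
    ; independent = independent
    ; absorbing   = absorbing
    ; dominating  = dominating
    }
    where
    module KG = IsBikernel KG
    module KH = IsBikernel KH

    nonempty : ∃ λ b → b ∈ (B ×ᵇ C)
    nonempty with KG.nonempty | KH.nonempty
    ... | g , g∈B | h , h∈C = (g , h) , ∈-×ᵇ⁺ B C g∈B h∈C

    independent : ∀ u v → u ∈ (B ×ᵇ C) → v ∈ (B ×ᵇ C) → u ≢ v →
                  ∀ c → ¬ MonoPath (G □ H) c u v
    independent (x , y) (x′ , y′) u∈ v∈ u≢v c p
      with ∈-×ᵇ⁻ B C u∈ | ∈-×ᵇ⁻ B C v∈ | x ≟ x′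
    ... | x∈B , y∈C | x′∈B , y′∈C | no x≢x′ =
      KG.independent x x′ x∈B x′∈B x≢x′ c (walk⇒path G (projˡ (path⇒walk (G □ H) p)) x≢x′)
    ... | x∈B , y∈C | x′∈B , y′∈C | yes refl =
      KH.independent y y′ y∈C y′∈C y≢y′ c (walk⇒path H (projʳ (path⇒walk (G □ H) p)) y≢y′)
      where
      y≢y′ : y ≢ y′
      y≢y′ y≡y′ = u≢v (cong (x ,_) y≡y′)

    absorbing : ∀ v → ¬ v ∈ (B ×ᵇ C) → ∃ λ b → b ∈ (B ×ᵇ C) × MonoPath (G □ H) c1 v b
    absorbing (x , y) v∉ with walkToKernel KG x | walkToKernel KH y
    ... | g , g∈B , p | h , h∈C , q =
      (g , h) , b∈ , walk⇒path (G □ H) (liftˡ y p ◅◅ liftʳ g q) (∉-∈⇒≢ (B ×ᵇ C) v∉ b∈)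
      where
      b∈ : (g , h) ∈ (B ×ᵇ C)
      b∈ = ∈-×ᵇ⁺ B C g∈B h∈C

    dominating : ∀ v → ¬ v ∈ (B ×ᵇ C) → ∃ λ b → b ∈ (B ×ᵇ C) × MonoPath (G □ H) c2 b v
    dominating (x , y) v∉ with walkFromKernel KG x | walkFromKernel KH y
    ... | g , g∈B , p | h , h∈C , q =
      (g , h) , b∈ , walk⇒path (G □ H) (liftʳ g q ◅◅ liftˡ y p) (≢-sym (∉-∈⇒≢ (B ×ᵇ C) v∉ b∈))
      where
      b∈ : (g , h) ∈ (B ×ᵇ C)
      b∈ = ∈-×ᵇ⁺ B C g∈B h∈C

mainTheorem5 : (G H : BiDigraph) → IsFiniteBiDigraph G → IsFiniteBiDigraph H →
               HasBikernel G → HasBikernel H → HasBikernel (G □ H)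
mainTheorem5 G H FG _ (B , KG) (C , KH) =
  B ×ᵇ C , □-isBikernel (finite⇒decidableEquality FG) KG KH
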